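{- Let $m,n,k\ge 2$ be integers and let $\phi:E(K_n)\to[k]$ be a coloring of the edges of $K_n$ using exactly two colors, each of which is used on more than $3mn$ edges. Then \[ w(\phi,k)\le 2^n+kn\,2^{n-0.4m}. \] Furthermore, at most $kn\,2^{n-0.4m}$ of these extensions use a color that is not used in $\phi$.
   Context: An edge coloring of a complete graph is a Gallai coloring if it contains no triangle whose three edges have three distinct colors (a 2-coloring is automatically Gallai). For a Gallai coloring $\phi$ of $E(K_n)$ with colors in $[k]=\{1,\dots,k\}$, $w(\phi,k)$ denotes the number of ways to extend $\phi$ to a Gallai coloring of $E(K_{n+1})$ (obtained by adding one new vertex joined to all vertices of $K_n$) in which the new edges receive colors from $[k]$. -}

module Defs where

open import Data.Nat using (ℕ; zero; suc)
open import Data.Fin using (Fin; _<_; _<?_)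
open import Data.Fin.Properties using (_≟_; all?; any?)
open import Data.List using (List; []; _∷_; [_]; map; concatMap; filter; length; allFin; cartesianProduct)
open import Data.Vec.Functional using () renaming (_∷_ to _∷ᶠ_)
open import Data.Product using (_×_; _,_; ∃; ∃-syntax; proj₁; proj₂)
open import Relation.Nullary using (¬_; Dec)
open import Relation.Nullary.Decidable using (_×-dec_; _→-dec_; ¬?)
open import Relation.Binary.PropositionalEquality using (_≡_; _≢_)

-- Values on the diagonal (i = i) are irrelevant and never inspected;
-- symmetry is imposed separately as a hypothesis.
Coloring : ℕ → ℕ → Set
Coloring n k = Fin n → Fin n → Fin k

Symmetric : ∀ {n k} → Coloring n k → Set
Symmetric c = ∀ i j → c i j ≡ c j i

Rainbow : ∀ {k} → Fin k → Fin k → Fin k → Set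
Rainbow a b d = a ≢ b × b ≢ d × a ≢ d

rainbow? : ∀ {k} (a b d : Fin k) → Dec (Rainbow a b d)
rainbow? a b d = ¬? (a ≟ b) ×-dec ¬? (b ≟ d) ×-dec ¬? (a ≟ d)

IsGallai : ∀ {n k} → Coloring n k → Set
IsGallai c = ∀ i j l → i ≢ j → j ≢ l → i ≢ l → ¬ Rainbow (c i j) (c j l) (c i l)

isGallai? : ∀ {n k} (c : Coloring n k) → Dec (IsGallai c)
isGallai? c = all? λ i → all? λ j → all? λ l →
  ¬? (i ≟ j) →-dec ¬? (j ≟ l) →-dec ¬? (i ≟ l) →-dec ¬? (rainbow? (c i j) (c j l) (c i l))

-- Extension to K_{n+1}: the new vertex is joined to vertex i by an edge of colour f i.
-- The extended colouring is Gallai iff the old triangles are non-rainbow (IsGallai c)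
-- and every triangle {new, i, j} is non-rainbow.
ExtGallai : ∀ {n k} → Coloring n k → (Fin n → Fin k) → Set
ExtGallai c f = IsGallai c × (∀ i j → i ≢ j → ¬ Rainbow (f i) (f j) (c i j))

extGallai? : ∀ {n k} (c : Coloring n k) (f : Fin n → Fin k) → Dec (ExtGallai c f)
extGallai? c f = isGallai? c ×-dec (all? λ i → all? λ j →
  ¬? (i ≟ j) →-dec ¬? (rainbow? (f i) (f j) (c i j)))

allFuns : (n k : ℕ) → List (Fin n → Fin k)
allFuns zero    k = [ (λ ()) ]
allFuns (suc n) k = concatMap (λ x → map (x ∷ᶠ_) (allFuns n k)) (allFin k)

w : ∀ {n k} → Coloring n k → ℕ
w {n} {k} c = length (filter (extGallai? c) (allFuns n k))

Used : ∀ {n k} → Coloring n k → Fin k → Set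
Used c x = ∃[ i ] ∃[ j ] (i ≢ j × c i j ≡ x)

used? : ∀ {n k} (c : Coloring n k) (x : Fin k) → Dec (Used c x)
used? c x = any? λ i → any? λ j → ¬? (i ≟ j) ×-dec (c i j ≟ x)

UsesNewColor : ∀ {n k} → Coloring n k → (Fin n → Fin k) → Set
UsesNewColor c f = ∃[ i ] ¬ Used c (f i)

usesNewColor? : ∀ {n k} (c : Coloring n k) (f : Fin n → Fin k) → Dec (UsesNewColor c f)
usesNewColor? c f = any? λ i → ¬? (used? c (f i))

wNew : ∀ {n k} → Coloring n k → ℕ
wNew {n} {k} c =
  length (filter (λ f → extGallai? c f ×-dec usesNewColor? c f) (allFuns n k))

edgeCount : ∀ {n k} → Coloring n k → Fin k → ℕ
edgeCount {n} c a =
  length (filter (λ p → (proj₁ p <? proj₂ p) ×-dec (c (proj₁ p) (proj₂ p) ≟ a))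
                 (cartesianProduct (allFin n) (allFin n)))

-- Fix a vertex v and a colour x not used by c.  If f is a Gallai extension with f v = x, then
-- f j ∈ {x, c v j} for every j ≠ v, because the triangle formed by the new vertex, v and j is
-- not rainbow.  As both colour classes have more than 3mn edges, greedily chosen disjoint pairs
-- p < q avoiding v with {v, p, q} not monochromatic number at least m: if a maximal family had
-- fewer pairs, the vertices left free would span a clique in the single colour c v w, so every
-- edge of the other colour would meet one of the at most 2m - 1 vertices v, p, q, giving at most
-- (2m - 1)n such edges.  For each pair, one of the four choices of (f p, f q) makes the triangle
-- {new vertex, p, q} rainbow, so at most 2^n (3/4)^m extensions send v to x.  Summing over v and
-- x gives wNew · 8^m ≤ kn · 2^n · 6^m, and (3/4)^5 ≤ 1/4 turns this into the stated bound.
-- An extension using only colours of c takes all its values in {a, b}, so w ≤ wNew + 2^n.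
-- The count with one excluded choice per pair is done with weights: if the weight of coordinate
-- j depends only on f 0, …, f j and its sum over the value of f j is at most B j, then the total
-- weight of all f is at most ∏ B j; the weights are chosen so that every admissible f weighs at
-- least 8^m while ∏ B j = 2^n · 6^m.

module Submission where

open import Defs
open import Data.Nat using (ℕ; _+_; _*_; _∸_; _^_; _≤_; _<_)
open import Data.Fin using (Fin)
open import Data.Product using (_×_; ∃-syntax)
open import Data.Sum using (_⊎_)
open import Relation.Binary.PropositionalEquality using (_≡_; _≢_)

open import Level using (Level)
open import Data.Bool using (Bool; true; false; not; if_then_else_)
open import Data.Empty using (⊥; ⊥-elim)
open import Data.Fin using (toℕ; _<?_) renaming (zero to fzero; suc to fsuc)
open import Data.Fin.Properties using (_≟_; any?; all?; <-cmp; <⇒≢)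
open import Data.List using (List; []; _∷_; map; length; filter; allFin; tabulate; cartesianProduct; concatMap; _++_)
open import Data.List.Properties using (map-tabulate)
open import Data.List.Relation.Unary.All as All using (All; []; _∷_)
open import Data.Nat using (zero; suc; z≤n; s≤s)
open import Data.Nat.Properties hiding (_≟_; _<?_; <-cmp; <⇒≢)
open import Algebra.Properties.CommutativeSemigroup +-commutativeSemigroup using () renaming (interchange to +-interchange)
open import Algebra.Properties.CommutativeSemigroup *-commutativeSemigroup using () renaming (interchange to *-interchange)
open import Data.Nat.Solver using (module +-*-Solver)
open import Data.Product using (_,_; proj₁; proj₂)
open import Data.Sum using (inj₁; inj₂) renaming (map to map-⊎)
open import Data.Unit using (tt)
open import Data.Vec.Functional using (updateAt) renaming (_∷_ to _∷ᶠ_)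
open import Data.Vec.Functional.Properties using (updateAt-updates; updateAt-minimal)
open import Function using (id; const; _∘_; case_of_)
open import Relation.Binary using (tri<; tri≈; tri>)
open import Relation.Binary.PropositionalEquality using (refl; sym; trans; cong; cong₂; module ≡-Reasoning)
open import Relation.Nullary using (¬_; Dec; yes; no; does)
open import Relation.Nullary.Decidable using (_×-dec_; _⊎-dec_; ¬?; decidable-stable)

private variable
  a b p q : Level
  A : Set a
  B : Set b

ite : ∀ {P : Set p} → Dec P → ℕ → ℕ → ℕ
ite d a b = if does d then a else b

𝟙 : ∀ {P : Set p} → Dec P → ℕ
𝟙 d = ite d 1 0

ite-yes : ∀ {P : Set p} (d : Dec P) {a b} → P → ite d a b ≡ a
ite-yes (yes _) _ = refl
ite-yes (no ¬p) p = ⊥-elim (¬p p)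

ite-no : ∀ {P : Set p} (d : Dec P) {a b} → ¬ P → ite d a b ≡ b
ite-no (yes p) ¬p = ⊥-elim (¬p p)
ite-no (no _) _ = refl

ite-congˡ : ∀ {P : Set p} (P? : Dec P) {a a′ b} → (P → a ≡ a′) → ite P? a b ≡ ite P? a′ b
ite-congˡ (yes p) a≡a′ = a≡a′ p
ite-congˡ (no _)  _    = refl

ite-≤ : ∀ {P : Set p} (P? : Dec P) {a b c} → a ≤ c → b ≤ c → ite P? a b ≤ c
ite-≤ (yes _) a≤c _ = a≤c
ite-≤ (no _)  _ b≤c = b≤c

𝟙*≡ite : ∀ {P : Set p} (d : Dec P) (a : ℕ) → 𝟙 d * a ≡ ite d a 0
𝟙*≡ite (yes _) a = +-identityʳ a
𝟙*≡ite (no _) a = refl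

𝟙-≤ : ∀ {P : Set p} (P? : Dec P) {r} → (P → 1 ≤ r) → 𝟙 P? ≤ r
𝟙-≤ (yes p) 1≤r = 1≤r p
𝟙-≤ (no _)  _   = z≤n

𝟙+𝟙≤1 : ∀ {P : Set p} {Q : Set q} (P? : Dec P) (Q? : Dec Q) → (P → Q → ⊥) → 𝟙 P? + 𝟙 Q? ≤ 1
𝟙+𝟙≤1 (yes p) (yes q) exclusive = ⊥-elim (exclusive p q)
𝟙+𝟙≤1 (yes _) (no _)  _ = ≤-refl
𝟙+𝟙≤1 (no _)  (yes _) _ = ≤-refl
𝟙+𝟙≤1 (no _)  (no _)  _ = z≤n

𝟙-⊎-≤ : ∀ {P : Set p} {Q : Set q} (P? : Dec P) (Q? : Dec Q) → 𝟙 (P? ⊎-dec Q?) ≤ 𝟙 P? + 𝟙 Q?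
𝟙-⊎-≤ (yes _) _       = s≤s z≤n
𝟙-⊎-≤ (no _)  (yes _) = ≤-refl
𝟙-⊎-≤ (no _)  (no _)  = z≤n

∑ : List A → (A → ℕ) → ℕ
∑ [] g = 0
∑ (x ∷ xs) g = g x + ∑ xs g

∏ : List A → (A → ℕ) → ℕ
∏ [] g = 1
∏ (x ∷ xs) g = g x * ∏ xs g

∑-const : ∀ (xs : List A) d → ∑ xs (const d) ≡ length xs * d
∑-const [] d = refl
∑-const (x ∷ xs) d = cong (d +_) (∑-const xs d)

∑-cong : ∀ xs {f g : A → ℕ} → (∀ x → f x ≡ g x) → ∑ xs f ≡ ∑ xs g
∑-cong [] _ = refl
∑-cong (x ∷ xs) f≡g = cong₂ _+_ (f≡g x) (∑-cong xs f≡g)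

∑-mono-≤ : ∀ xs {f g : A → ℕ} → (∀ x → f x ≤ g x) → ∑ xs f ≤ ∑ xs g
∑-mono-≤ [] _ = z≤n
∑-mono-≤ (x ∷ xs) f≤g = +-mono-≤ (f≤g x) (∑-mono-≤ xs f≤g)

∑-distrib-+ : ∀ xs (f g : A → ℕ) → ∑ xs (λ x → f x + g x) ≡ ∑ xs f + ∑ xs g
∑-distrib-+ [] f g = refl
∑-distrib-+ (x ∷ xs) f g =
  trans (cong (f x + g x +_) (∑-distrib-+ xs f g)) (+-interchange (f x) (g x) _ _)

∑-distribˡ-* : ∀ xs c (f : A → ℕ) → ∑ xs (λ x → c * f x) ≡ c * ∑ xs f
∑-distribˡ-* [] c f = sym (*-zeroʳ c)
∑-distribˡ-* (x ∷ xs) c f = trans (cong (c * f x +_) (∑-distribˡ-* xs c f)) (sym (*-distribˡ-+ c (f x) _))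

∑-++ : ∀ xs ys (f : A → ℕ) → ∑ (xs ++ ys) f ≡ ∑ xs f + ∑ ys f
∑-++ [] ys f = refl
∑-++ (x ∷ xs) ys f = trans (cong (f x +_) (∑-++ xs ys f)) (sym (+-assoc (f x) _ _))

∑-map : ∀ (g : B → A) xs (f : A → ℕ) → ∑ (map g xs) f ≡ ∑ xs (f ∘ g)
∑-map g [] f = refl
∑-map g (x ∷ xs) f = cong (f (g x) +_) (∑-map g xs f)

∑-concatMap : ∀ (F : B → List A) xs (f : A → ℕ) →
  ∑ (concatMap F xs) f ≡ ∑ xs (λ x → ∑ (F x) f)
∑-concatMap F [] f = refl
∑-concatMap F (x ∷ xs) f = trans (∑-++ (F x) _ f) (cong (∑ (F x) f +_) (∑-concatMap F xs f))

∑-comm : ∀ xs (ys : List B) (f : A → B → ℕ) →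
  ∑ xs (λ x → ∑ ys (f x)) ≡ ∑ ys (λ y → ∑ xs (λ x → f x y))
∑-comm [] ys f = sym (trans (∑-const ys 0) (*-zeroʳ (length ys)))
∑-comm (x ∷ xs) ys f =
  trans (cong (∑ ys (f x) +_) (∑-comm xs ys f)) (sym (∑-distrib-+ ys (f x) _))

∑-cartesianProduct : ∀ xs (ys : List B) (f : A × B → ℕ) →
  ∑ (cartesianProduct xs ys) f ≡ ∑ xs (λ x → ∑ ys (λ y → f (x , y)))
∑-cartesianProduct [] ys f = refl
∑-cartesianProduct (x ∷ xs) ys f =
  trans (∑-++ (map (x ,_) ys) _ f) (cong₂ _+_ (∑-map (x ,_) ys f) (∑-cartesianProduct xs ys f))

length-filter≡∑𝟙 : ∀ {P : A → Set p} (P? : ∀ x → Dec (P x)) xs →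
  length (filter P? xs) ≡ ∑ xs (λ x → 𝟙 (P? x))
length-filter≡∑𝟙 P? [] = refl
length-filter≡∑𝟙 P? (x ∷ xs) with does (P? x)
... | true  = cong suc (length-filter≡∑𝟙 P? xs)
... | false = length-filter≡∑𝟙 P? xs

∑𝟙≡0 : ∀ {P : A → Set p} (P? : ∀ x → Dec (P x)) xs → (∀ x → ¬ P x) → ∑ xs (λ x → 𝟙 (P? x)) ≡ 0
∑𝟙≡0 P? [] _ = refl
∑𝟙≡0 P? (x ∷ xs) ¬P = trans (cong (_+ ∑ xs (λ x → 𝟙 (P? x))) (ite-no (P? x) (¬P x))) (∑𝟙≡0 P? xs ¬P)

∑𝟙*≤∑ : ∀ {P : A → Set p} (P? : ∀ x → Dec (P x)) xs (C : ℕ) (wt : A → ℕ) →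
  (∀ x → P x → C ≤ wt x) → ∑ xs (λ x → 𝟙 (P? x)) * C ≤ ∑ xs wt
∑𝟙*≤∑ P? xs C wt C≤wt = begin
  ∑ xs (λ x → 𝟙 (P? x)) * C   ≡⟨ *-comm _ C ⟩
  C * ∑ xs (λ x → 𝟙 (P? x))   ≡⟨ ∑-distribˡ-* xs C _ ⟨
  ∑ xs (λ x → C * 𝟙 (P? x))   ≤⟨ ∑-mono-≤ xs pointwise ⟩
  ∑ xs wt                      ∎
  where
  open ≤-Reasoning
  pointwise : ∀ x → C * 𝟙 (P? x) ≤ wt x
  pointwise x with P? x
  ... | yes px = ≤-trans (≤-reflexive (*-identityʳ C)) (C≤wt x px)
  ... | no _   = ≤-trans (≤-reflexive (*-zeroʳ C)) z≤n

∏-cong : ∀ xs {f g : A → ℕ} → (∀ x → f x ≡ g x) → ∏ xs f ≡ ∏ xs g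
∏-cong [] _ = refl
∏-cong (x ∷ xs) f≡g = cong₂ _*_ (f≡g x) (∏-cong xs f≡g)

∏-const : ∀ xs d → ∏ xs (λ (_ : A) → d) ≡ d ^ length xs
∏-const [] d = refl
∏-const (x ∷ xs) d = cong (d *_) (∏-const xs d)

∑ᶠ : ∀ {n} → (Fin n → ℕ) → ℕ
∑ᶠ {zero} g = 0
∑ᶠ {suc n} g = g fzero + ∑ᶠ (g ∘ fsuc)

∏ᶠ : ∀ {n} → (Fin n → ℕ) → ℕ
∏ᶠ {zero} g = 1
∏ᶠ {suc n} g = g fzero * ∏ᶠ (g ∘ fsuc)

∑-allFin : ∀ n (g : Fin n → ℕ) → ∑ (allFin n) g ≡ ∑ᶠ g
∑-allFin zero g = refl
∑-allFin (suc n) g = cong (g fzero +_) (begin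
  ∑ (tabulate fsuc) g        ≡⟨ cong (λ xs → ∑ xs g) (map-tabulate id fsuc) ⟨
  ∑ (map fsuc (allFin n)) g  ≡⟨ ∑-map fsuc (allFin n) g ⟩
  ∑ (allFin n) (g ∘ fsuc)    ≡⟨ ∑-allFin n (g ∘ fsuc) ⟩
  ∑ᶠ (g ∘ fsuc)              ∎)
  where open ≡-Reasoning

∑ᶠ-cong : ∀ {n} {f g : Fin n → ℕ} → (∀ i → f i ≡ g i) → ∑ᶠ f ≡ ∑ᶠ g
∑ᶠ-cong {zero} _ = refl
∑ᶠ-cong {suc n} f≡g = cong₂ _+_ (f≡g fzero) (∑ᶠ-cong (f≡g ∘ fsuc))

∑ᶠ-mono-≤ : ∀ {n} {f g : Fin n → ℕ} → (∀ i → f i ≤ g i) → ∑ᶠ f ≤ ∑ᶠ g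
∑ᶠ-mono-≤ {zero} _ = z≤n
∑ᶠ-mono-≤ {suc n} f≤g = +-mono-≤ (f≤g fzero) (∑ᶠ-mono-≤ (f≤g ∘ fsuc))

∑ᶠ-distrib-+ : ∀ {n} (f g : Fin n → ℕ) → ∑ᶠ (λ i → f i + g i) ≡ ∑ᶠ f + ∑ᶠ g
∑ᶠ-distrib-+ {zero} f g = refl
∑ᶠ-distrib-+ {suc n} f g =
  trans (cong (f fzero + g fzero +_) (∑ᶠ-distrib-+ (f ∘ fsuc) (g ∘ fsuc))) (+-interchange (f fzero) (g fzero) _ _)

∑ᶠ-distribʳ-* : ∀ {n} c (f : Fin n → ℕ) → ∑ᶠ (λ i → f i * c) ≡ ∑ᶠ f * c
∑ᶠ-distribʳ-* {zero} c f = refl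
∑ᶠ-distribʳ-* {suc n} c f =
  trans (cong (f fzero * c +_) (∑ᶠ-distribʳ-* c (f ∘ fsuc))) (sym (*-distribʳ-+ c (f fzero) _))

∑ᶠ-const : ∀ {n} d → ∑ᶠ (λ (_ : Fin n) → d) ≡ n * d
∑ᶠ-const {zero} d = refl
∑ᶠ-const {suc n} d = cong (d +_) (∑ᶠ-const {n} d)

∑ᶠ-zero : ∀ {n} → ∑ᶠ (λ (_ : Fin n) → 0) ≡ 0
∑ᶠ-zero {n} = trans (∑ᶠ-const {n} 0) (*-zeroʳ n)

∑ᶠ-ite-≟ : ∀ {n} (u : Fin n) (g : Fin n → ℕ) → ∑ᶠ (λ i → ite (i ≟ u) (g i) 0) ≡ g u
∑ᶠ-ite-≟ {suc n} fzero g = trans (cong (g fzero +_) (∑ᶠ-zero {n})) (+-identityʳ (g fzero))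
∑ᶠ-ite-≟ {suc n} (fsuc u) g = ∑ᶠ-ite-≟ u (g ∘ fsuc)

∑ᶠ-ite : ∀ {n} {P : Set p} (P? : Dec P) (g : Fin n → ℕ) → ∑ᶠ (λ j → ite P? (g j) 0) ≡ ite P? (∑ᶠ g) 0
∑ᶠ-ite (yes _) g = refl
∑ᶠ-ite {n = n} (no _) g = ∑ᶠ-zero {n}

∑ᶠ-𝟙-≟ : ∀ {n} (u : Fin n) → ∑ᶠ (λ i → 𝟙 (i ≟ u)) ≡ 1
∑ᶠ-𝟙-≟ u = ∑ᶠ-ite-≟ u (const 1)

≤∑ᶠ : ∀ {n} (u : Fin n) (g : Fin n → ℕ) → g u ≤ ∑ᶠ g
≤∑ᶠ {suc n} fzero g = m≤m+n (g fzero) _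
≤∑ᶠ {suc n} (fsuc u) g = ≤-trans (≤∑ᶠ u (g ∘ fsuc)) (m≤n+m _ (g fzero))

∑-∑ᶠ-comm : ∀ {n} xs (g : A → Fin n → ℕ) → ∑ xs (λ x → ∑ᶠ (g x)) ≡ ∑ᶠ (λ i → ∑ xs (λ x → g x i))
∑-∑ᶠ-comm {n = n} xs g = begin
  ∑ xs (λ x → ∑ᶠ (g x))                 ≡⟨ ∑-cong xs (λ x → sym (∑-allFin n (g x))) ⟩
  ∑ xs (λ x → ∑ (allFin n) (g x))       ≡⟨ ∑-comm xs (allFin n) g ⟩
  ∑ (allFin n) (λ i → ∑ xs (λ x → g x i)) ≡⟨ ∑-allFin n _ ⟩
  ∑ᶠ (λ i → ∑ xs (λ x → g x i))         ∎
  where open ≡-Reasoning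

∏ᶠ-mono-≤ : ∀ {n} {f g : Fin n → ℕ} → (∀ i → f i ≤ g i) → ∏ᶠ f ≤ ∏ᶠ g
∏ᶠ-mono-≤ {zero} _ = ≤-refl
∏ᶠ-mono-≤ {suc n} f≤g = *-mono-≤ (f≤g fzero) (∏ᶠ-mono-≤ (f≤g ∘ fsuc))

∏ᶠ-distrib-* : ∀ {n} (f g : Fin n → ℕ) → ∏ᶠ (λ i → f i * g i) ≡ ∏ᶠ f * ∏ᶠ g
∏ᶠ-distrib-* {zero} f g = refl
∏ᶠ-distrib-* {suc n} f g =
  trans (cong (f fzero * g fzero *_) (∏ᶠ-distrib-* (f ∘ fsuc) (g ∘ fsuc))) (*-interchange (f fzero) (g fzero) _ _)

∏ᶠ-const : ∀ {n} d → ∏ᶠ (λ (_ : Fin n) → d) ≡ d ^ n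
∏ᶠ-const {zero} d = refl
∏ᶠ-const {suc n} d = cong (d *_) (∏ᶠ-const {n} d)

∏ᶠ-one : ∀ {n} → ∏ᶠ (λ (_ : Fin n) → 1) ≡ 1
∏ᶠ-one {n} = trans (∏ᶠ-const {n} 1) (^-zeroˡ n)

∏ᶠ-ite-≟ : ∀ {n} (u : Fin n) d → ∏ᶠ (λ i → ite (i ≟ u) d 1) ≡ d
∏ᶠ-ite-≟ {suc n} fzero d = trans (cong (d *_) (∏ᶠ-one {n})) (*-identityʳ d)
∏ᶠ-ite-≟ {suc n} (fsuc u) d = trans (+-identityʳ _) (∏ᶠ-ite-≟ u d)

∏ᶠ-∏-comm : ∀ {n} xs (g : A → Fin n → ℕ) → ∏ᶠ (λ i → ∏ xs (λ x → g x i)) ≡ ∏ xs (λ x → ∏ᶠ (g x))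
∏ᶠ-∏-comm {n = n} [] g = ∏ᶠ-one {n}
∏ᶠ-∏-comm (x ∷ xs) g = trans (∏ᶠ-distrib-* (g x) _) (cong (∏ᶠ (g x) *_) (∏ᶠ-∏-comm xs g))

∑ᶠ-two-points : ∀ {n} (u w : Fin n) (g : Fin n → ℕ) → ∑ᶠ (λ i → (𝟙 (i ≟ u) + 𝟙 (i ≟ w)) * g i) ≡ g u + g w
∑ᶠ-two-points u w g = begin
  ∑ᶠ (λ i → (𝟙 (i ≟ u) + 𝟙 (i ≟ w)) * g i)
    ≡⟨ ∑ᶠ-cong (λ i → trans (*-distribʳ-+ (g i) (𝟙 (i ≟ u)) _)
                            (cong₂ _+_ (𝟙*≡ite (i ≟ u) (g i)) (𝟙*≡ite (i ≟ w) (g i)))) ⟩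
  ∑ᶠ (λ i → ite (i ≟ u) (g i) 0 + ite (i ≟ w) (g i) 0)
    ≡⟨ ∑ᶠ-distrib-+ (λ i → ite (i ≟ u) (g i) 0) (λ i → ite (i ≟ w) (g i) 0) ⟩
  ∑ᶠ (λ i → ite (i ≟ u) (g i) 0) + ∑ᶠ (λ i → ite (i ≟ w) (g i) 0)
    ≡⟨ cong₂ _+_ (∑ᶠ-ite-≟ u g) (∑ᶠ-ite-≟ w g) ⟩
  g u + g w ∎
  where open ≡-Reasoning

∑ᶠ-≤-inhabited : ∀ {k} (g : Fin k → ℕ) {B} → (Fin k → ∑ᶠ g ≤ B) → ∑ᶠ g ≤ B
∑ᶠ-≤-inhabited {zero} g _ = z≤n
∑ᶠ-≤-inhabited {suc k} g bound = bound fzero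

module _ {k : ℕ} where

  ∑-allFuns-suc : ∀ n (F : (Fin (suc n) → Fin k) → ℕ) →
    ∑ (allFuns (suc n) k) F ≡ ∑ᶠ (λ y → ∑ (allFuns n k) (λ g → F (y ∷ᶠ g)))
  ∑-allFuns-suc n F = begin
      ∑ (concatMap (λ y → map (y ∷ᶠ_) (allFuns n k)) (allFin k)) F
    ≡⟨ ∑-concatMap _ (allFin k) F ⟩
      ∑ (allFin k) (λ y → ∑ (map (y ∷ᶠ_) (allFuns n k)) F)
    ≡⟨ ∑-cong (allFin k) (λ y → ∑-map (y ∷ᶠ_) (allFuns n k) F) ⟩
      ∑ (allFin k) (λ y → ∑ (allFuns n k) (λ g → F (y ∷ᶠ g)))
    ≡⟨ ∑-allFin k _ ⟩
      ∑ᶠ (λ y → ∑ (allFuns n k) (λ g → F (y ∷ᶠ g))) ∎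
    where open ≡-Reasoning

  DependsOnPrefix : ∀ {n} → (Fin n → (Fin n → Fin k) → ℕ) → Set
  DependsOnPrefix h = ∀ j f g → (∀ i → toℕ i ≤ toℕ j → f i ≡ g i) → h j f ≡ h j g

  FibresBoundedBy : ∀ {n} → (Fin n → (Fin n → Fin k) → ℕ) → (Fin n → ℕ) → Set
  FibresBoundedBy h B = ∀ j f → ∑ᶠ (λ y → h j (updateAt f j (const y))) ≤ B j

  ∑-∏ᶠ-≤-∏ᶠ : ∀ n (h : Fin n → (Fin n → Fin k) → ℕ) (B : Fin n → ℕ) →
    DependsOnPrefix h → FibresBoundedBy h B → ∑ (allFuns n k) (λ f → ∏ᶠ (λ j → h j f)) ≤ ∏ᶠ B
  ∑-∏ᶠ-≤-∏ᶠ zero h B _ _ = ≤-refl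
  ∑-∏ᶠ-≤-∏ᶠ (suc n) h B prefix fibres = begin
      ∑ (allFuns (suc n) k) (λ f → ∏ᶠ (λ j → h j f))
    ≡⟨ ∑-allFuns-suc n _ ⟩
      ∑ᶠ (λ y → ∑ (allFuns n k) (λ g → h fzero (y ∷ᶠ g) * ∏ᶠ (λ j → tailWeight y j g)))
    ≡⟨ ∑ᶠ-cong (λ y → ∑-cong (allFuns n k) λ g →
         cong (_* ∏ᶠ (λ j → tailWeight y j g)) (head-only y g)) ⟩
      ∑ᶠ (λ y → ∑ (allFuns n k) (λ g → headWeight y * ∏ᶠ (λ j → tailWeight y j g)))
    ≡⟨ ∑ᶠ-cong (λ y → ∑-distribˡ-* (allFuns n k) (headWeight y) _) ⟩
      ∑ᶠ (λ y → headWeight y * ∑ (allFuns n k) (λ g → ∏ᶠ (λ j → tailWeight y j g)))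
    ≤⟨ ∑ᶠ-mono-≤ (λ y → *-monoʳ-≤ (headWeight y)
         (∑-∏ᶠ-≤-∏ᶠ n (tailWeight y) (B ∘ fsuc) (tail-prefix y) (tail-fibres y))) ⟩
      ∑ᶠ (λ y → headWeight y * ∏ᶠ (B ∘ fsuc))
    ≡⟨ ∑ᶠ-distribʳ-* _ headWeight ⟩
      ∑ᶠ headWeight * ∏ᶠ (B ∘ fsuc)
    ≤⟨ *-monoˡ-≤ _ head-fibre ⟩
      B fzero * ∏ᶠ (B ∘ fsuc) ∎
    where
    open ≤-Reasoning
    headWeight : Fin k → ℕ
    headWeight y = h fzero (const y)
    tailWeight : Fin k → Fin n → (Fin n → Fin k) → ℕ
    tailWeight y j g = h (fsuc j) (y ∷ᶠ g)
    same-head : ∀ {f g : Fin (suc n) → Fin k} → f fzero ≡ g fzero → ∀ i → toℕ i ≤ 0 → f i ≡ g i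
    same-head head≡ fzero _ = head≡
    same-head head≡ (fsuc i) ()
    head-only : ∀ y g → h fzero (y ∷ᶠ g) ≡ headWeight y
    head-only y g = prefix fzero (y ∷ᶠ g) (const y) (same-head refl)
    head-fibre : ∑ᶠ headWeight ≤ B fzero
    head-fibre = ∑ᶠ-≤-inhabited headWeight λ y₀ → ≤-trans
      (≤-reflexive (∑ᶠ-cong λ y → prefix fzero (const y) (updateAt (const y₀) fzero (const y)) (same-head refl)))
      (fibres fzero (const y₀))
    tail-prefix : ∀ y → DependsOnPrefix (tailWeight y)
    tail-prefix y j g g′ agree = prefix (fsuc j) (y ∷ᶠ g) (y ∷ᶠ g′) λ where
      fzero    _           → refl
      (fsuc i) (s≤s i≤j) → agree i i≤j
    ∷-updateAt : ∀ y (g : Fin n → Fin k) j z i →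
      (y ∷ᶠ updateAt g j (const z)) i ≡ updateAt (y ∷ᶠ g) (fsuc j) (const z) i
    ∷-updateAt y g j z fzero    = refl
    ∷-updateAt y g j z (fsuc i) = refl
    tail-fibres : ∀ y → FibresBoundedBy (tailWeight y) (B ∘ fsuc)
    tail-fibres y j g = ≤-trans
      (≤-reflexive (∑ᶠ-cong λ z → prefix (fsuc j) _ _ λ i _ → ∷-updateAt y g j z i))
      (fibres (fsuc j) (y ∷ᶠ g))

  ∑𝟙-twoValued≤2^ : ∀ n (a b : Fin k) →
    ∑ (allFuns n k) (λ f → 𝟙 (all? λ j → (f j ≟ a) ⊎-dec (f j ≟ b))) ≤ 2 ^ n
  ∑𝟙-twoValued≤2^ n a b = begin
      ∑ (allFuns n k) (λ f → 𝟙 (twoValued? f))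
    ≡⟨ *-identityʳ _ ⟨
      ∑ (allFuns n k) (λ f → 𝟙 (twoValued? f)) * 1
    ≤⟨ ∑𝟙*≤∑ twoValued? (allFuns n k) 1 (λ f → ∏ᶠ (λ j → inPair j f)) (λ f twoValued →
         ≤-trans (≤-reflexive (sym (∏ᶠ-one {n})))
                 (∏ᶠ-mono-≤ λ j → ≤-reflexive (sym (ite-yes (inPair? (f j)) (twoValued j))))) ⟩
      ∑ (allFuns n k) (λ f → ∏ᶠ (λ j → inPair j f))
    ≤⟨ ∑-∏ᶠ-≤-∏ᶠ n inPair (const 2) (λ j f g agree → cong (𝟙 ∘ inPair?) (agree j ≤-refl)) fibres ⟩
      ∏ᶠ {n} (const 2)
    ≡⟨ ∏ᶠ-const {n} 2 ⟩
      2 ^ n ∎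
    where
    open ≤-Reasoning
    inPair? : ∀ y → Dec (y ≡ a ⊎ y ≡ b)
    inPair? y = (y ≟ a) ⊎-dec (y ≟ b)
    twoValued? : ∀ (f : Fin n → Fin k) → Dec (∀ j → f j ≡ a ⊎ f j ≡ b)
    twoValued? f = all? λ j → inPair? (f j)
    inPair : Fin n → (Fin n → Fin k) → ℕ
    inPair j f = 𝟙 (inPair? (f j))
    fibres : FibresBoundedBy inPair (const 2)
    fibres j f = begin
        ∑ᶠ (λ y → 𝟙 (inPair? (updateAt f j (const y) j)))
      ≡⟨ ∑ᶠ-cong (λ y → cong (𝟙 ∘ inPair?) (updateAt-updates j {const y} f)) ⟩
        ∑ᶠ (λ y → 𝟙 (inPair? y))
      ≤⟨ ∑ᶠ-mono-≤ (λ y → 𝟙-⊎-≤ (y ≟ a) (y ≟ b)) ⟩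
        ∑ᶠ (λ y → 𝟙 (y ≟ a) + 𝟙 (y ≟ b))
      ≡⟨ ∑ᶠ-distrib-+ (λ y → 𝟙 (y ≟ a)) (λ y → 𝟙 (y ≟ b)) ⟩
        ∑ᶠ (λ y → 𝟙 (y ≟ a)) + ∑ᶠ (λ y → 𝟙 (y ≟ b))
      ≡⟨ cong₂ _+_ (∑ᶠ-𝟙-≟ a) (∑ᶠ-𝟙-≟ b) ⟩
        2 ∎

module Matchings {n k : ℕ} (c : Coloring n k) where

  Pair : Set
  Pair = Fin n × Fin n

  Monochromatic : Fin n → Fin n → Fin n → Set
  Monochromatic v p q = c v p ≡ c p q × c p q ≡ c v q

  monochromatic? : ∀ v p q → Dec (Monochromatic v p q)
  monochromatic? v p q = (c v p ≟ c p q) ×-dec (c p q ≟ c v q)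

  Untouched : List Pair → Fin n → Set
  Untouched M j = All (λ P → proj₁ P ≢ j × proj₂ P ≢ j) M

  Free : Fin n → List Pair → Fin n → Set
  Free v M j = j ≢ v × Untouched M j

  free? : ∀ v M j → Dec (Free v M j)
  free? v M j = ¬? (j ≟ v) ×-dec All.all? (λ P → ¬? (proj₁ P ≟ j) ×-dec ¬? (proj₂ P ≟ j)) M

  data NonMonoMatching (v : Fin n) : List Pair → Set where
    [] : NonMonoMatching v []
    extend : ∀ {p q M} → NonMonoMatching v M → toℕ p < toℕ q → ¬ Monochromatic v p q →
             Free v M p → Free v M q → NonMonoMatching v ((p , q) ∷ M)

  Maximal : Fin n → List Pair → Set
  Maximal v M = ∀ p q → toℕ p < toℕ q → Free v M p → Free v M q → Monochromatic v p q

  greedy : ∀ v t → (∃[ M ] NonMonoMatching v M × length M ≡ t) ⊎ (∃[ M ] length M < t × Maximal v M)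
  greedy v zero = inj₁ ([] , [] , refl)
  greedy v (suc t) with greedy v t
  ... | inj₂ (M , short , maximal) = inj₂ (M , m<n⇒m<1+n short , maximal)
  ... | inj₁ (M , matching , refl) with any? (λ p → any? λ q →
          (p <? q) ×-dec free? v M p ×-dec free? v M q ×-dec ¬? (monochromatic? v p q))
  ...   | yes (p , q , p<q , free-p , free-q , nonmono) =
          inj₁ ((p , q) ∷ M , extend matching p<q nonmono free-p free-q , refl)
  ...   | no none = inj₂ (M , ≤-refl , λ p q p<q free-p free-q →
          decidable-stable (monochromatic? v p q) λ nonmono → none (p , q , p<q , free-p , free-q , nonmono))

  ∑-endpoints : Fin n → List Pair → (Fin n → ℕ) → ℕ
  ∑-endpoints v M g = g v + ∑ M (λ P → g (proj₁ P) + g (proj₂ P))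

  ∑-endpoints-mono-≤ : ∀ v M {f g : Fin n → ℕ} → (∀ u → f u ≤ g u) → ∑-endpoints v M f ≤ ∑-endpoints v M g
  ∑-endpoints-mono-≤ v M f≤g = +-mono-≤ (f≤g v) (∑-mono-≤ M λ P → +-mono-≤ (f≤g (proj₁ P)) (f≤g (proj₂ P)))

  ∑-∑-endpoints-comm : ∀ v M (xs : List A) (g : Fin n → A → ℕ) →
    ∑ xs (λ x → ∑-endpoints v M (λ u → g u x)) ≡ ∑-endpoints v M (λ u → ∑ xs (g u))
  ∑-∑-endpoints-comm v M xs g = begin
    ∑ xs (λ x → g v x + ∑ M (λ P → g (proj₁ P) x + g (proj₂ P) x))
      ≡⟨ ∑-distrib-+ xs (g v) _ ⟩
    ∑ xs (g v) + ∑ xs (λ x → ∑ M (λ P → g (proj₁ P) x + g (proj₂ P) x))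
      ≡⟨ cong (∑ xs (g v) +_) (∑-comm xs M _) ⟩
    ∑ xs (g v) + ∑ M (λ P → ∑ xs (λ x → g (proj₁ P) x + g (proj₂ P) x))
      ≡⟨ cong (∑ xs (g v) +_) (∑-cong M λ P → ∑-distrib-+ xs (g (proj₁ P)) (g (proj₂ P))) ⟩
    ∑-endpoints v M (λ u → ∑ xs (g u)) ∎
    where open ≡-Reasoning

  ∑-endpoints-const : ∀ v M d → ∑-endpoints v M (const d) ≡ d + length M * (d + d)
  ∑-endpoints-const v M d = cong (d +_) (∑-const M (d + d))

  ¬free⇒endpoint : ∀ v M j → ¬ Free v M j → 1 ≤ ∑-endpoints v M (λ u → 𝟙 (j ≟ u))
  ¬free⇒endpoint v M j ¬free with j ≟ v
  ... | yes refl = s≤s z≤n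
  ... | no j≢v = ≤-trans (touched M λ untouched → ¬free (j≢v , untouched)) (m≤n+m _ _)
    where
    touched : ∀ M → ¬ Untouched M j → 1 ≤ ∑ M (λ P → 𝟙 (j ≟ proj₁ P) + 𝟙 (j ≟ proj₂ P))
    touched [] ¬untouched = ⊥-elim (¬untouched [])
    touched ((p , q) ∷ M) ¬untouched with j ≟ p | j ≟ q
    ... | yes _ | _     = s≤s z≤n
    ... | no _  | yes _ = s≤s z≤n
    ... | no j≢p | no j≢q = touched M λ untouched → ¬untouched ((j≢p ∘ sym , j≢q ∘ sym) ∷ untouched)

  Incident : Fin n → Pair → Set
  Incident u (i , j) = toℕ i < toℕ j × (i ≡ u ⊎ j ≡ u)

  incident? : ∀ u P → Dec (Incident u P)
  incident? u (i , j) = (i <? j) ×-dec ((i ≟ u) ⊎-dec (j ≟ u))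

  pairs : List Pair
  pairs = cartesianProduct (allFin n) (allFin n)

  ∑-pairs : (g : Pair → ℕ) → ∑ pairs g ≡ ∑ᶠ (λ i → ∑ᶠ (λ j → g (i , j)))
  ∑-pairs g = trans (∑-cartesianProduct (allFin n) (allFin n) g)
    (trans (∑-allFin n _) (∑ᶠ-cong λ i → ∑-allFin n (λ j → g (i , j))))

  degree≤n : ∀ u → ∑ pairs (λ P → 𝟙 (incident? u P)) ≤ n
  degree≤n u = begin
      ∑ pairs (λ P → 𝟙 (incident? u P))
    ≡⟨ ∑-pairs _ ⟩
      ∑ᶠ (λ i → ∑ᶠ (λ j → 𝟙 (incident? u (i , j))))
    ≤⟨ ∑ᶠ-mono-≤ (λ i → ∑ᶠ-mono-≤ (split i)) ⟩
      ∑ᶠ (λ i → ∑ᶠ (λ j → out i j + into i j))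
    ≡⟨ ∑ᶠ-cong (λ i → ∑ᶠ-distrib-+ (out i) (into i)) ⟩
      ∑ᶠ (λ i → ∑ᶠ (out i) + ∑ᶠ (into i))
    ≡⟨ ∑ᶠ-cong (λ i → cong₂ _+_ (∑ᶠ-ite (i ≟ u) later) (∑ᶠ-ite-≟ u (λ _ → earlier i))) ⟩
      ∑ᶠ (λ i → ite (i ≟ u) (∑ᶠ later) 0 + earlier i)
    ≡⟨ ∑ᶠ-distrib-+ (λ i → ite (i ≟ u) (∑ᶠ later) 0) earlier ⟩
      ∑ᶠ (λ i → ite (i ≟ u) (∑ᶠ later) 0) + ∑ᶠ earlier
    ≡⟨ cong (_+ ∑ᶠ earlier) (∑ᶠ-ite-≟ u (λ _ → ∑ᶠ later)) ⟩
      ∑ᶠ later + ∑ᶠ earlier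
    ≡⟨ ∑ᶠ-distrib-+ later earlier ⟨
      ∑ᶠ (λ j → later j + earlier j)
    ≤⟨ ∑ᶠ-mono-≤ {n} (λ j → 𝟙+𝟙≤1 (u <? j) (j <? u) <-asym) ⟩
      ∑ᶠ {n} (λ _ → 1)
    ≡⟨ trans (∑ᶠ-const {n} 1) (*-identityʳ n) ⟩
      n ∎
    where
    open ≤-Reasoning
    later earlier : Fin n → ℕ
    later j = 𝟙 (u <? j)
    earlier i = 𝟙 (i <? u)
    out into : Fin n → Fin n → ℕ
    out i j = ite (i ≟ u) (later j) 0
    into i j = ite (j ≟ u) (earlier i) 0
    split : ∀ i j → 𝟙 (incident? u (i , j)) ≤ out i j + into i j
    split i j = 𝟙-≤ (incident? u (i , j)) λ where
      (i<j , inj₁ refl) → ≤-trans (≤-reflexive (sym (trans (ite-yes (i ≟ i) refl) (ite-yes (i <? j) i<j))))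
                                  (m≤m+n _ _)
      (i<j , inj₂ refl) → ≤-trans (≤-reflexive (sym (trans (ite-yes (j ≟ j) refl) (ite-yes (i <? j) i<j))))
                                  (m≤n+m _ _)

  edgeCount≤ : ∀ β v M → (∀ i j → toℕ i < toℕ j → c i j ≡ β → ¬ Free v M i ⊎ ¬ Free v M j) →
    edgeCount c β ≤ n + length M * (n + n)
  edgeCount≤ β v M touching = begin
      edgeCount c β
    ≡⟨ length-filter≡∑𝟙 edge? pairs ⟩
      ∑ pairs (λ P → 𝟙 (edge? P))
    ≤⟨ ∑-mono-≤ pairs edge≤ ⟩
      ∑ pairs (λ P → ∑-endpoints v M (λ u → 𝟙 (incident? u P)))
    ≡⟨ ∑-∑-endpoints-comm v M pairs _ ⟩
      ∑-endpoints v M (λ u → ∑ pairs (λ P → 𝟙 (incident? u P)))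
    ≤⟨ ∑-endpoints-mono-≤ v M degree≤n ⟩
      ∑-endpoints v M (const n)
    ≡⟨ ∑-endpoints-const v M n ⟩
      n + length M * (n + n) ∎
    where
    open ≤-Reasoning
    edge? : ∀ P → Dec (toℕ (proj₁ P) < toℕ (proj₂ P) × c (proj₁ P) (proj₂ P) ≡ β)
    edge? P = (proj₁ P <? proj₂ P) ×-dec (c (proj₁ P) (proj₂ P) ≟ β)
    endpoint-incident : ∀ {i j e} → toℕ i < toℕ j → i ≡ e ⊎ j ≡ e → ∀ u → 𝟙 (e ≟ u) ≤ 𝟙 (incident? u (i , j))
    endpoint-incident {i} {j} {e} i<j end u =
      𝟙-≤ (e ≟ u) λ { refl → ≤-reflexive (sym (ite-yes (incident? e (i , j)) (i<j , end))) }
    edge≤ : ∀ P → 𝟙 (edge? P) ≤ ∑-endpoints v M (λ u → 𝟙 (incident? u P))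
    edge≤ (i , j) = 𝟙-≤ (edge? (i , j)) λ (i<j , colour) → case touching i j i<j colour of λ where
      (inj₁ ¬free-i) → ≤-trans (¬free⇒endpoint v M i ¬free-i)
                               (∑-endpoints-mono-≤ v M (endpoint-incident i<j (inj₁ refl)))
      (inj₂ ¬free-j) → ≤-trans (¬free⇒endpoint v M j ¬free-j)
                               (∑-endpoints-mono-≤ v M (endpoint-incident i<j (inj₂ refl)))

  maximal⇒free-edges-monochromatic : ∀ {v M w} → Maximal v M → Free v M w →
    ∀ i j → toℕ i < toℕ j → Free v M i → Free v M j → c i j ≡ c v w
  maximal⇒free-edges-monochromatic {v} {M} {w} maximal free-w i j i<j free-i free-j =
    trans (sym (proj₁ (maximal i j i<j free-i free-j))) (spoke-colour i free-i)
    where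
    spoke-colour : ∀ u → Free v M u → c v u ≡ c v w
    spoke-colour u free-u with <-cmp u w
    ... | tri< u<w _ _ = let (e₁ , e₂) = maximal u w u<w free-u free-w in trans e₁ e₂
    ... | tri≈ _ refl _ = refl
    ... | tri> _ _ w<u = let (e₁ , e₂) = maximal w u w<u free-w free-u in sym (trans e₁ e₂)

  module _ {m : ℕ} {a b : Fin k} (a≢b : a ≢ b)
           (many-a : 3 * m * n < edgeCount c a) (many-b : 3 * m * n < edgeCount c b) where

    another-colour : ∀ α → ∃[ β ] β ≢ α × 3 * m * n < edgeCount c β
    another-colour α with α ≟ a
    ... | yes refl = b , a≢b ∘ sym , many-b
    ... | no α≢a   = a , α≢a ∘ sym , many-a

    few-edges : ∀ {β v M} → length M < m →
      (∀ i j → toℕ i < toℕ j → c i j ≡ β → ¬ Free v M i ⊎ ¬ Free v M j) → edgeCount c β ≤ 3 * m * n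
    few-edges {β} {v} {M} short touching = begin
      edgeCount c β                  ≤⟨ edgeCount≤ β v M touching ⟩
      n + length M * (n + n)         ≤⟨ +-monoˡ-≤ (length M * (n + n)) (m≤m+n n n) ⟩
      suc (length M) * (n + n)       ≤⟨ *-monoˡ-≤ (n + n) short ⟩
      m * (n + n)                    ≤⟨ m≤m+n (m * (n + n)) (m * n) ⟩
      m * (n + n) + m * n            ≡⟨ solve 2 (λ m n → m :* (n :+ n) :+ m :* n := con 3 :* m :* n) refl m n ⟩
      3 * m * n                      ∎
      where
      open ≤-Reasoning
      open +-*-Solver

    colour-avoiding-free-edges : ∀ {v M} → Maximal v M → ∃[ β ] 3 * m * n < edgeCount c β ×
      (∀ i j → toℕ i < toℕ j → c i j ≡ β → ¬ Free v M i ⊎ ¬ Free v M j)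
    colour-avoiding-free-edges {v} {M} maximal with any? (free? v M)
    ... | no none = a , many-a , λ i _ _ _ → inj₁ λ free-i → none (i , free-i)
    ... | yes (w , free-w) with another-colour (c v w)
    ...   | β , β≢cvw , many-β = β , many-β , touching
      where
      touching : ∀ i j → toℕ i < toℕ j → c i j ≡ β → ¬ Free v M i ⊎ ¬ Free v M j
      touching i j i<j colour with free? v M i | free? v M j
      ... | yes free-i | yes free-j = ⊥-elim (β≢cvw (trans (sym colour)
                                        (maximal⇒free-edges-monochromatic maximal free-w i j i<j free-i free-j)))
      ... | no ¬free-i | _          = inj₁ ¬free-i
      ... | yes _      | no ¬free-j = inj₂ ¬free-j

    maximal⇒long : ∀ {v M} → Maximal v M → m ≤ length M
    maximal⇒long maximal = ≮⇒≥ λ short →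
      let (β , many-β , touching) = colour-avoiding-free-edges maximal in <⇒≱ many-β (few-edges short touching)

    nonMonoMatching : ∀ v → ∃[ M ] NonMonoMatching v M × length M ≡ m
    nonMonoMatching v with greedy v m
    ... | inj₁ found = found
    ... | inj₂ (M , short , maximal) = ⊥-elim (<⇒≱ short (maximal⇒long maximal))

onPair : ∀ {n} → Fin n × Fin n → Fin n → ℕ → ℕ → ℕ
onPair (p , q) j A B = ite (j ≟ p) A 1 * ite (j ≟ q) B 1

module _ {n : ℕ} {p q : Fin n} {A B : ℕ} where

  onPair-first : p ≢ q → onPair (p , q) p A B ≡ A
  onPair-first p≢q = trans (cong₂ _*_ (ite-yes (p ≟ p) refl) (ite-no (p ≟ q) p≢q)) (*-identityʳ A)

  onPair-second : p ≢ q → onPair (p , q) q A B ≡ B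
  onPair-second p≢q = trans (cong₂ _*_ (ite-no (q ≟ p) (p≢q ∘ sym)) (ite-yes (q ≟ q) refl)) (*-identityˡ B)

  onPair-cong : ∀ {j A′ B′} → (j ≡ p → A ≡ A′) → (j ≡ q → B ≡ B′) → onPair (p , q) j A B ≡ onPair (p , q) j A′ B′
  onPair-cong {j} A≡A′ B≡B′ = cong₂ _*_ (ite-congˡ (j ≟ p) A≡A′) (ite-congˡ (j ≟ q) B≡B′)

  onPair-elsewhere : ∀ {j} → j ≢ p → j ≢ q → onPair (p , q) j A B ≡ 1
  onPair-elsewhere {j} j≢p j≢q = cong₂ _*_ (ite-no (j ≟ p) j≢p) (ite-no (j ≟ q) j≢q)

  ∏ᶠ-onPair : ∏ᶠ (λ j → onPair (p , q) j A B) ≡ A * B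
  ∏ᶠ-onPair = trans (∏ᶠ-distrib-* (λ j → ite (j ≟ p) A 1) (λ j → ite (j ≟ q) B 1))
                    (cong₂ _*_ (∏ᶠ-ite-≟ p A) (∏ᶠ-ite-≟ q B))

∏-onPair-untouched : ∀ {n} {j : Fin n} M (A B : Fin n × Fin n → ℕ) → All (λ P → proj₁ P ≢ j × proj₂ P ≢ j) M →
  ∏ M (λ P → onPair P j (A P) (B P)) ≡ 1
∏-onPair-untouched [] A B [] = refl
∏-onPair-untouched (P ∷ M) A B ((p≢j , q≢j) ∷ untouched) =
  cong₂ _*_ (onPair-elsewhere (p≢j ∘ sym) (q≢j ∘ sym)) (∏-onPair-untouched M A B untouched)

module NewColourAt {n k : ℕ} (c : Coloring n k) (v : Fin n) (x : Fin k) (unused : ¬ Used c x) where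

  open Matchings c

  x≢colour : ∀ {i j} → i ≢ j → x ≢ c i j
  x≢colour i≢j x≡cij = unused (_ , _ , i≢j , sym x≡cij)

  x≢spoke : ∀ {j} → j ≢ v → x ≢ c v j
  x≢spoke j≢v = x≢colour (j≢v ∘ sym)

  -- Given f p ∈ {x, c v p} and f q ∈ {x, c v q}, a pair with {v, p, q} not monochromatic rules out
  -- exactly one choice of (f p, f q): (c v p, x) if c p q ≡ c v q, and (x, c v q) otherwise.
  -- Choosing f p = y with forces P y leaves only f q = forced P.  The product first · second is 8
  -- on the three admissible choices, while first sums to 6 over f p and second to at most 4 over f q.
  forces : Pair → Fin k → Bool
  forces (p , q) y = if does (c p q ≟ c v q) then not (does (y ≟ x)) else does (y ≟ x)

  forced : Pair → Fin k
  forced (p , q) = if does (c p q ≟ c v q) then c v q else x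

  first : Pair → Fin k → ℕ
  first P y = if forces P y then 2 else 4

  second : Pair → Fin k → Fin k → ℕ
  second P y z = if forces P y then 4 * 𝟙 (z ≟ forced P) else 2

  spoke : Fin n → Fin k → ℕ
  spoke j y = ite (j ≟ v) (𝟙 (y ≟ x)) (𝟙 (y ≟ x) + 𝟙 (y ≟ c v j))

  pairWeight : (Fin n → Fin k) → Pair → ℕ
  pairWeight f P = first P (f (proj₁ P)) * second P (f (proj₁ P)) (f (proj₂ P))

  pairFactors : List Pair → Fin n → (Fin n → Fin k) → ℕ
  pairFactors M j f = ∏ M (λ P → onPair P j (first P (f (proj₁ P))) (second P (f (proj₁ P)) (f (proj₂ P))))

  weight : List Pair → Fin n → (Fin n → Fin k) → ℕ
  weight M j f = spoke j (f j) * pairFactors M j f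

  bound : List Pair → Fin n → ℕ
  bound M j = 2 * ∏ M (λ P → onPair P j 3 2)

  first-x+first-spoke : ∀ {p q} → p ≢ v → first (p , q) x + first (p , q) (c v p) ≡ 6
  first-x+first-spoke {p} {q} p≢v with c p q ≟ c v q | x ≟ x | c v p ≟ x
  ... | _     | no x≢x | _         = ⊥-elim (x≢x refl)
  ... | _     | _      | yes cvp≡x = ⊥-elim (x≢spoke p≢v (sym cvp≡x))
  ... | yes _ | yes _  | no _      = refl
  ... | no _  | yes _  | no _      = refl

  second-x+second-spoke≤4 : ∀ {p q} → q ≢ v → ∀ y → second (p , q) y x + second (p , q) y (c v q) ≤ 4
  second-x+second-spoke≤4 {p} {q} q≢v y with forces (p , q) y
  ... | false = ≤-refl
  ... | true  = begin
      4 * 𝟙 (x ≟ z) + 4 * 𝟙 (c v q ≟ z)   ≡⟨ *-distribˡ-+ 4 (𝟙 (x ≟ z)) (𝟙 (c v q ≟ z)) ⟨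
      4 * (𝟙 (x ≟ z) + 𝟙 (c v q ≟ z))     ≤⟨ *-monoʳ-≤ 4 (𝟙+𝟙≤1 (x ≟ z) (c v q ≟ z) λ x≡z cvq≡z →
                                                x≢spoke q≢v (trans x≡z (sym cvq≡z))) ⟩
      4                                    ∎
    where
    open ≤-Reasoning
    z : Fin k
    z = forced (p , q)

  ∏ᶠ-weight : ∀ M f → ∏ᶠ (λ j → weight M j f) ≡ ∏ᶠ (λ j → spoke j (f j)) * ∏ M (pairWeight f)
  ∏ᶠ-weight M f = trans (∏ᶠ-distrib-* (λ j → spoke j (f j)) _)
    (cong (∏ᶠ (λ j → spoke j (f j)) *_)
      (trans (∏ᶠ-∏-comm {n = n} M _) (∏-cong M λ P → ∏ᶠ-onPair {p = proj₁ P} {proj₂ P})))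

  ∏ᶠ-bound : ∀ M → ∏ᶠ (bound M) ≡ 2 ^ n * 6 ^ length M
  ∏ᶠ-bound M = begin
    ∏ᶠ (bound M)
      ≡⟨ ∏ᶠ-distrib-* (λ _ → 2) (λ j → ∏ M (λ P → onPair P j 3 2)) ⟩
    ∏ᶠ {n} (λ _ → 2) * ∏ᶠ (λ j → ∏ M (λ P → onPair P j 3 2))
      ≡⟨ cong₂ _*_ (∏ᶠ-const {n} 2) (∏ᶠ-∏-comm {n = n} M (λ P j → onPair P j 3 2)) ⟩
    2 ^ n * ∏ M (λ P → ∏ᶠ (λ j → onPair P j 3 2))
      ≡⟨ cong (2 ^ n *_) (trans (∏-cong M λ P → ∏ᶠ-onPair {p = proj₁ P} {proj₂ P}) (∏-const M 6)) ⟩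
    2 ^ n * 6 ^ length M                            ∎
    where open ≡-Reasoning

  module _ {f : Fin n → Fin k} (ext : ExtGallai c f) (f-v : f v ≡ x) where

    spoke-choice : ∀ {j} → j ≢ v → f j ≡ x ⊎ f j ≡ c v j
    spoke-choice {j} j≢v with f j ≟ x | f j ≟ c v j
    ... | yes fj≡x | _ = inj₁ fj≡x
    ... | no _ | yes fj≡cvj = inj₂ fj≡cvj
    ... | no fj≢x | no fj≢cvj = ⊥-elim (proj₂ ext v j (j≢v ∘ sym)
            ( (λ x≡fj → fj≢x (trans (sym x≡fj) f-v))
            , fj≢cvj
            , λ fv≡cvj → x≢spoke j≢v (trans (sym f-v) fv≡cvj)))

    forced-respected : ∀ {p q} → p ≢ q → p ≢ v → q ≢ v → ¬ Monochromatic v p q →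
      forces (p , q) (f p) ≡ true → f q ≡ forced (p , q)
    forced-respected {p} {q} p≢q p≢v q≢v nonmono forcing with c p q ≟ c v q | f p ≟ x
    forced-respected p≢q p≢v q≢v nonmono () | yes _ | yes _
    forced-respected p≢q p≢v q≢v nonmono () | no _  | no _
    forced-respected {p} {q} p≢q p≢v q≢v nonmono _ | yes cpq≡cvq | no fp≢x
      with spoke-choice p≢v | spoke-choice q≢v
    ... | inj₁ fp≡x   | _           = ⊥-elim (fp≢x fp≡x)
    ... | inj₂ _      | inj₂ fq≡cvq = fq≡cvq
    ... | inj₂ fp≡cvp | inj₁ fq≡x   = ⊥-elim (proj₂ ext p q p≢q
          ( (λ fp≡fq → fp≢x (trans fp≡fq fq≡x))
          , (λ fq≡cpq → x≢colour p≢q (trans (sym fq≡x) fq≡cpq))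
          , λ fp≡cpq → nonmono (trans (sym fp≡cvp) fp≡cpq , cpq≡cvq)))
    forced-respected {p} {q} p≢q p≢v q≢v nonmono _ | no cpq≢cvq | yes fp≡x with spoke-choice q≢v
    ... | inj₁ fq≡x   = fq≡x
    ... | inj₂ fq≡cvq = ⊥-elim (proj₂ ext p q p≢q
          ( (λ fp≡fq → x≢spoke q≢v (trans (sym fp≡x) (trans fp≡fq fq≡cvq)))
          , (λ fq≡cpq → cpq≢cvq (trans (sym fq≡cpq) fq≡cvq))
          , λ fp≡cpq → x≢colour p≢q (trans (sym fp≡x) fp≡cpq)))

    first*second≥8 : ∀ {p q} → p ≢ q → p ≢ v → q ≢ v → ¬ Monochromatic v p q →
      8 ≤ first (p , q) (f p) * second (p , q) (f p) (f q)
    first*second≥8 {p} {q} p≢q p≢v q≢v nonmono with forces (p , q) (f p) in forcing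
    ... | false = ≤-refl
    ... | true  = ≤-reflexive (sym (cong (λ t → 2 * (4 * t))
                    (ite-yes (f q ≟ forced (p , q)) (forced-respected p≢q p≢v q≢v nonmono forcing))))

    1≤spoke : ∀ j → 1 ≤ spoke j (f j)
    1≤spoke j with j ≟ v
    ... | yes refl = ≤-reflexive (sym (ite-yes (f j ≟ x) f-v))
    ... | no j≢v with spoke-choice j≢v
    ...   | inj₁ fj≡x   = ≤-trans (≤-reflexive (sym (ite-yes (f j ≟ x) fj≡x))) (m≤m+n _ _)
    ...   | inj₂ fj≡cvj = ≤-trans (≤-reflexive (sym (ite-yes (f j ≟ c v j) fj≡cvj))) (m≤n+m _ _)

    8^≤∏pairWeight : ∀ {M} → NonMonoMatching v M → 8 ^ length M ≤ ∏ M (pairWeight f)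
    8^≤∏pairWeight [] = ≤-refl
    8^≤∏pairWeight (extend matching p<q nonmono (p≢v , _) (q≢v , _)) =
      *-mono-≤ (first*second≥8 (<⇒≢ p<q) p≢v q≢v nonmono) (8^≤∏pairWeight matching)

    8^≤∏ᶠweight : ∀ {M} → NonMonoMatching v M → 8 ^ length M ≤ ∏ᶠ (λ j → weight M j f)
    8^≤∏ᶠweight {M} matching = begin
      8 ^ length M                                          ≡⟨ *-identityˡ _ ⟨
      1 * 8 ^ length M                                      ≤⟨ *-mono-≤ (≤-trans (≤-reflexive (sym (∏ᶠ-one {n})))
                                                                                  (∏ᶠ-mono-≤ 1≤spoke))
                                                                         (8^≤∏pairWeight matching) ⟩
      ∏ᶠ (λ j → spoke j (f j)) * ∏ M (pairWeight f)        ≡⟨ ∏ᶠ-weight M f ⟨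
      ∏ᶠ (λ j → weight M j f)                               ∎
      where open ≤-Reasoning

  weight-prefix : ∀ {M} → NonMonoMatching v M → DependsOnPrefix (weight M)
  weight-prefix matching j f g agree = cong₂ _*_ (cong (spoke j) (agree j ≤-refl)) (pairs-agree matching)
    where
    pairs-agree : ∀ {M} → NonMonoMatching v M → pairFactors M j f ≡ pairFactors M j g
    pairs-agree [] = refl
    pairs-agree (extend {p} {q} matching p<q _ _ _) = cong₂ _*_
      (onPair-cong {p = p} {q = q} {j = j} (λ { refl → cong (first (p , q)) (agree p ≤-refl) })
                   (λ { refl → cong₂ (second (p , q)) (agree p (<⇒≤ p<q)) (agree q ≤-refl) }))
      (pairs-agree matching)

  ∑ᶠ-spoke≤2 : ∀ j → ∑ᶠ (spoke j) ≤ 2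
  ∑ᶠ-spoke≤2 j = begin
      ∑ᶠ (spoke j)
    ≤⟨ ∑ᶠ-mono-≤ {k} (λ y → ite-≤ (j ≟ v) (m≤m+n (𝟙 (y ≟ x)) _) ≤-refl) ⟩
      ∑ᶠ (λ y → 𝟙 (y ≟ x) + 𝟙 (y ≟ c v j))
    ≡⟨ ∑ᶠ-distrib-+ (λ y → 𝟙 (y ≟ x)) (λ y → 𝟙 (y ≟ c v j)) ⟩
      ∑ᶠ (λ y → 𝟙 (y ≟ x)) + ∑ᶠ (λ y → 𝟙 (y ≟ c v j))
    ≡⟨ cong₂ _+_ (∑ᶠ-𝟙-≟ x) (∑ᶠ-𝟙-≟ (c v j)) ⟩
      2 ∎
    where open ≤-Reasoning

  module _ {p q : Fin n} {M : List Pair} (p≢q : p ≢ q) where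

    weight-first : p ≢ v → Untouched M p → ∀ g →
      weight ((p , q) ∷ M) p g ≡ (𝟙 (g p ≟ x) + 𝟙 (g p ≟ c v p)) * first (p , q) (g p)
    weight-first p≢v untouched g = cong₂ _*_ (ite-no (p ≟ v) p≢v)
      (trans (cong₂ _*_ (onPair-first p≢q) (∏-onPair-untouched M _ _ untouched)) (*-identityʳ _))

    weight-second : q ≢ v → Untouched M q → ∀ g →
      weight ((p , q) ∷ M) q g ≡ (𝟙 (g q ≟ x) + 𝟙 (g q ≟ c v q)) * second (p , q) (g p) (g q)
    weight-second q≢v untouched g = cong₂ _*_ (ite-no (q ≟ v) q≢v)
      (trans (cong₂ _*_ (onPair-second p≢q) (∏-onPair-untouched M _ _ untouched)) (*-identityʳ _))

    bound-first : Untouched M p → bound ((p , q) ∷ M) p ≡ 6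
    bound-first untouched = cong (2 *_) (cong₂ _*_ (onPair-first p≢q) (∏-onPair-untouched M _ _ untouched))

    bound-second : Untouched M q → bound ((p , q) ∷ M) q ≡ 4
    bound-second untouched = cong (2 *_) (cong₂ _*_ (onPair-second p≢q) (∏-onPair-untouched M _ _ untouched))

    fibre-first : p ≢ v → Untouched M p → ∀ f →
      ∑ᶠ (λ y → weight ((p , q) ∷ M) p (updateAt f p (const y))) ≤ bound ((p , q) ∷ M) p
    fibre-first p≢v untouched f = begin
        ∑ᶠ (λ y → weight ((p , q) ∷ M) p (updateAt f p (const y)))
      ≡⟨ ∑ᶠ-cong (λ y → trans (weight-first p≢v untouched (updateAt f p (const y)))
           (cong (λ t → (𝟙 (t ≟ x) + 𝟙 (t ≟ c v p)) * first (p , q) t) (updateAt-updates p {const y} f))) ⟩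
        ∑ᶠ (λ y → (𝟙 (y ≟ x) + 𝟙 (y ≟ c v p)) * first (p , q) y)
      ≡⟨ ∑ᶠ-two-points x (c v p) (first (p , q)) ⟩
        first (p , q) x + first (p , q) (c v p)
      ≡⟨ trans (first-x+first-spoke p≢v) (sym (bound-first untouched)) ⟩
        bound ((p , q) ∷ M) p ∎
      where open ≤-Reasoning

    fibre-second : q ≢ v → Untouched M q → ∀ f →
      ∑ᶠ (λ y → weight ((p , q) ∷ M) q (updateAt f q (const y))) ≤ bound ((p , q) ∷ M) q
    fibre-second q≢v untouched f = begin
        ∑ᶠ (λ y → weight ((p , q) ∷ M) q (updateAt f q (const y)))
      ≡⟨ ∑ᶠ-cong (λ y → trans (weight-second q≢v untouched (updateAt f q (const y)))
           (cong₂ (λ s t → (𝟙 (t ≟ x) + 𝟙 (t ≟ c v q)) * second (p , q) s t)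
                  (updateAt-minimal p q {const y} f p≢q) (updateAt-updates q {const y} f))) ⟩
        ∑ᶠ (λ y → (𝟙 (y ≟ x) + 𝟙 (y ≟ c v q)) * second (p , q) (f p) y)
      ≡⟨ ∑ᶠ-two-points x (c v q) (second (p , q) (f p)) ⟩
        second (p , q) (f p) x + second (p , q) (f p) (c v q)
      ≤⟨ second-x+second-spoke≤4 q≢v (f p) ⟩
        4
      ≡⟨ bound-second untouched ⟨
        bound ((p , q) ∷ M) q ∎
      where open ≤-Reasoning

  weight-elsewhere : ∀ {p q j M} → j ≢ p → j ≢ q → ∀ g → weight ((p , q) ∷ M) j g ≡ weight M j g
  weight-elsewhere {p} {q} {j} {M} j≢p j≢q g = cong (spoke j (g j) *_)
    (trans (cong (_* pairFactors M j g) (onPair-elsewhere j≢p j≢q)) (*-identityˡ _))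

  bound-elsewhere : ∀ {p q j M} → j ≢ p → j ≢ q → bound ((p , q) ∷ M) j ≡ bound M j
  bound-elsewhere {j = j} {M = M} j≢p j≢q =
    cong (2 *_) (trans (cong (_* ∏ M (λ P → onPair P j 3 2)) (onPair-elsewhere j≢p j≢q)) (*-identityˡ _))

  weight-fibres : ∀ {M} → NonMonoMatching v M → FibresBoundedBy (weight M) (bound M)
  weight-fibres [] j f = ≤-trans
    (≤-reflexive (∑ᶠ-cong {k} λ y → trans (*-identityʳ _) (cong (spoke j) (updateAt-updates j {const y} f))))
    (∑ᶠ-spoke≤2 j)
  weight-fibres (extend {p} {q} {M} matching p<q _ (p≢v , untouched-p) (q≢v , untouched-q)) j f =
    by-position (j ≟ p) (j ≟ q)
    where
    open ≤-Reasoning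
    p≢q : p ≢ q
    p≢q = <⇒≢ p<q
    by-position : Dec (j ≡ p) → Dec (j ≡ q) →
      ∑ᶠ (λ y → weight ((p , q) ∷ M) j (updateAt f j (const y))) ≤ bound ((p , q) ∷ M) j
    by-position (yes refl) (yes j≡q) = ⊥-elim (p≢q j≡q)
    by-position (yes refl) (no _)    = fibre-first p≢q p≢v untouched-p f
    by-position (no _)     (yes refl) = fibre-second p≢q q≢v untouched-q f
    by-position (no j≢p)   (no j≢q)  = begin
        ∑ᶠ (λ y → weight ((p , q) ∷ M) j (updateAt f j (const y)))
      ≡⟨ ∑ᶠ-cong (λ y → weight-elsewhere {M = M} j≢p j≢q (updateAt f j (const y))) ⟩
        ∑ᶠ (λ y → weight M j (updateAt f j (const y)))
      ≤⟨ weight-fibres matching j f ⟩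
        bound M j
      ≡⟨ bound-elsewhere {M = M} j≢p j≢q ⟨
        bound ((p , q) ∷ M) j ∎

module Counting {n k : ℕ} (c : Coloring n k) where

  open Matchings c

  NewAt : Fin n → Fin k → (Fin n → Fin k) → Set
  NewAt v x f = ExtGallai c f × f v ≡ x × ¬ Used c x

  newAt? : ∀ v x f → Dec (NewAt v x f)
  newAt? v x f = extGallai? c f ×-dec (f v ≟ x) ×-dec ¬? (used? c x)

  #newAt : Fin n → Fin k → ℕ
  #newAt v x = ∑ (allFuns n k) (λ f → 𝟙 (newAt? v x f))

  #newAt*8^≤ : ∀ {v M} → NonMonoMatching v M → ∀ x → #newAt v x * 8 ^ length M ≤ 2 ^ n * 6 ^ length M
  #newAt*8^≤ {v} {M} matching x = by-usage (used? c x)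
    where
    open ≤-Reasoning
    by-usage : Dec (Used c x) → #newAt v x * 8 ^ length M ≤ 2 ^ n * 6 ^ length M
    by-usage (yes used) = ≤-trans (≤-reflexive (cong (_* 8 ^ length M)
      (∑𝟙≡0 (newAt? v x) (allFuns n k) λ _ (_ , _ , unused) → unused used))) z≤n
    by-usage (no unused) = begin
        #newAt v x * 8 ^ length M
      ≤⟨ ∑𝟙*≤∑ (newAt? v x) (allFuns n k) _ (λ f → ∏ᶠ (λ j → weight M j f))
           (λ f (ext , f-v , _) → 8^≤∏ᶠweight ext f-v matching) ⟩
        ∑ (allFuns n k) (λ f → ∏ᶠ (λ j → weight M j f))
      ≤⟨ ∑-∏ᶠ-≤-∏ᶠ n (weight M) (bound M) (weight-prefix matching) (weight-fibres matching) ⟩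
        ∏ᶠ (bound M)
      ≡⟨ ∏ᶠ-bound M ⟩
        2 ^ n * 6 ^ length M ∎
      where open NewColourAt c v x unused

  wNew≤∑#newAt : wNew c ≤ ∑ᶠ (λ v → ∑ᶠ (λ x → #newAt v x))
  wNew≤∑#newAt = begin
      wNew c
    ≡⟨ length-filter≡∑𝟙 _ (allFuns n k) ⟩
      ∑ (allFuns n k) (λ f → 𝟙 (extGallai? c f ×-dec usesNewColor? c f))
    ≤⟨ ∑-mono-≤ (allFuns n k) (λ f → 𝟙-≤ (extGallai? c f ×-dec usesNewColor? c f) (newAt-somewhere f)) ⟩
      ∑ (allFuns n k) (λ f → ∑ᶠ (λ v → ∑ᶠ (λ x → 𝟙 (newAt? v x f))))
    ≡⟨ ∑-∑ᶠ-comm (allFuns n k) (λ f v → ∑ᶠ (λ x → 𝟙 (newAt? v x f))) ⟩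
      ∑ᶠ (λ v → ∑ (allFuns n k) (λ f → ∑ᶠ (λ x → 𝟙 (newAt? v x f))))
    ≡⟨ ∑ᶠ-cong (λ v → ∑-∑ᶠ-comm (allFuns n k) (λ f x → 𝟙 (newAt? v x f))) ⟩
      ∑ᶠ (λ v → ∑ᶠ (λ x → #newAt v x)) ∎
    where
    open ≤-Reasoning
    newAt-somewhere : ∀ f → ExtGallai c f × UsesNewColor c f → 1 ≤ ∑ᶠ (λ v → ∑ᶠ (λ x → 𝟙 (newAt? v x f)))
    newAt-somewhere f (ext , i , unused) = begin
      1                                          ≡⟨ ite-yes (newAt? i (f i) f) (ext , refl , unused) ⟨
      𝟙 (newAt? i (f i) f)                       ≤⟨ ≤∑ᶠ (f i) (λ x → 𝟙 (newAt? i x f)) ⟩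
      ∑ᶠ (λ x → 𝟙 (newAt? i x f))                ≤⟨ ≤∑ᶠ i (λ v → ∑ᶠ (λ x → 𝟙 (newAt? v x f))) ⟩
      ∑ᶠ (λ v → ∑ᶠ (λ x → 𝟙 (newAt? v x f)))     ∎

  w≤wNew+2^n : ∀ {a b} → (∀ i j → i ≢ j → c i j ≡ a ⊎ c i j ≡ b) → w c ≤ wNew c + 2 ^ n
  w≤wNew+2^n {a} {b} two = begin
      w c
    ≡⟨ length-filter≡∑𝟙 (extGallai? c) (allFuns n k) ⟩
      ∑ (allFuns n k) (λ f → 𝟙 (extGallai? c f))
    ≤⟨ ∑-mono-≤ (allFuns n k) split ⟩
      ∑ (allFuns n k) (λ f → 𝟙 (extGallai? c f ×-dec usesNewColor? c f) + 𝟙 (twoValued? f))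
    ≡⟨ ∑-distrib-+ (allFuns n k) _ _ ⟩
      ∑ (allFuns n k) (λ f → 𝟙 (extGallai? c f ×-dec usesNewColor? c f))
        + ∑ (allFuns n k) (λ f → 𝟙 (twoValued? f))
    ≤⟨ +-mono-≤ (≤-reflexive (sym (length-filter≡∑𝟙 _ (allFuns n k)))) (∑𝟙-twoValued≤2^ n a b) ⟩
      wNew c + 2 ^ n ∎
    where
    open ≤-Reasoning
    twoValued? : ∀ (f : Fin n → Fin k) → Dec (∀ j → f j ≡ a ⊎ f j ≡ b)
    twoValued? f = all? λ j → (f j ≟ a) ⊎-dec (f j ≟ b)
    old-colours : ∀ {f} → ¬ UsesNewColor c f → ∀ j → f j ≡ a ⊎ f j ≡ b
    old-colours {f} old j with decidable-stable (used? c (f j)) (λ unused → old (j , unused))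
    ... | i , i′ , i≢i′ , colour = map-⊎ (trans (sym colour)) (trans (sym colour)) (two i i′ i≢i′)
    split : ∀ f → 𝟙 (extGallai? c f) ≤ 𝟙 (extGallai? c f ×-dec usesNewColor? c f) + 𝟙 (twoValued? f)
    split f = by-cases (extGallai? c f) (usesNewColor? c f)
      where
      by-cases : (ext? : Dec (ExtGallai c f)) (new? : Dec (UsesNewColor c f)) →
        𝟙 ext? ≤ 𝟙 (ext? ×-dec new?) + 𝟙 (twoValued? f)
      by-cases (no _)  _       = z≤n
      by-cases (yes _) (yes _) = s≤s z≤n
      by-cases (yes _) (no old) =
        ≤-trans (≤-reflexive (sym (ite-yes (twoValued? f) (old-colours old)))) (m≤n+m _ _)

  wNew*8^≤ : ∀ {m a b} → a ≢ b → 3 * m * n < edgeCount c a → 3 * m * n < edgeCount c b →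
    wNew c * 8 ^ m ≤ n * (k * (2 ^ n * 6 ^ m))
  wNew*8^≤ {m} a≢b many-a many-b = begin
      wNew c * 8 ^ m
    ≤⟨ *-monoˡ-≤ (8 ^ m) wNew≤∑#newAt ⟩
      ∑ᶠ (λ v → ∑ᶠ (#newAt v)) * 8 ^ m
    ≡⟨ ∑ᶠ-distribʳ-* (8 ^ m) (λ v → ∑ᶠ (#newAt v)) ⟨
      ∑ᶠ (λ v → ∑ᶠ (#newAt v) * 8 ^ m)
    ≡⟨ ∑ᶠ-cong (λ v → ∑ᶠ-distribʳ-* (8 ^ m) (#newAt v)) ⟨
      ∑ᶠ (λ v → ∑ᶠ (λ x → #newAt v x * 8 ^ m))
    ≤⟨ ∑ᶠ-mono-≤ (λ v → ∑ᶠ-mono-≤ (#newAt*8^m≤ v)) ⟩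
      ∑ᶠ {n} (λ _ → ∑ᶠ {k} (λ _ → 2 ^ n * 6 ^ m))
    ≡⟨ trans (∑ᶠ-cong {n} (λ _ → ∑ᶠ-const {k} (2 ^ n * 6 ^ m))) (∑ᶠ-const {n} _) ⟩
      n * (k * (2 ^ n * 6 ^ m)) ∎
    where
    open ≤-Reasoning
    #newAt*8^m≤ : ∀ v x → #newAt v x * 8 ^ m ≤ 2 ^ n * 6 ^ m
    #newAt*8^m≤ v x with nonMonoMatching {m} a≢b many-a many-b v
    ... | M , matching , refl = #newAt*8^≤ matching x

^-distribʳ-* : ∀ a b e → (a * b) ^ e ≡ a ^ e * b ^ e
^-distribʳ-* a b zero = refl
^-distribʳ-* a b (suc e) = trans (cong (a * b *_) (^-distribʳ-* a b e)) (*-interchange a b (a ^ e) (b ^ e))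

^-comm : ∀ a b e → (a ^ b) ^ e ≡ (a ^ e) ^ b
^-comm a b e = trans (^-*-assoc a b e) (trans (cong (a ^_) (*-comm b e)) (sym (^-*-assoc a e b)))

8^-bound⇒fifth-power-bound : ∀ W m n k → W * 8 ^ m ≤ n * (k * (2 ^ n * 6 ^ m)) →
  W ^ 5 * 2 ^ (2 * m) ≤ (k * n) ^ 5 * 2 ^ (5 * n)
8^-bound⇒fifth-power-bound W m n k W8^m≤ =
  *-cancelʳ-≤ _ _ ((8 ^ 5) ^ m) {{m^n≢0 (8 ^ 5) m}} (begin
      W ^ 5 * 2 ^ (2 * m) * (8 ^ 5) ^ m
    ≡⟨ cong₂ (λ s t → W ^ 5 * s * t) (sym (^-*-assoc 2 2 m)) (^-comm 8 5 m) ⟩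
      W ^ 5 * 4 ^ m * (8 ^ m) ^ 5
    ≡⟨ solve 3 (λ w f e → w :* f :* e := w :* e :* f) refl (W ^ 5) (4 ^ m) ((8 ^ m) ^ 5) ⟩
      W ^ 5 * (8 ^ m) ^ 5 * 4 ^ m
    ≡⟨ cong (_* 4 ^ m) (^-distribʳ-* W (8 ^ m) 5) ⟨
      (W * 8 ^ m) ^ 5 * 4 ^ m
    ≤⟨ *-monoˡ-≤ (4 ^ m) (^-monoˡ-≤ 5 W8^m≤) ⟩
      (n * (k * (2 ^ n * 6 ^ m))) ^ 5 * 4 ^ m
    ≡⟨ expand n k (2 ^ n) (6 ^ m) (4 ^ m) ⟩
      (k * n) ^ 5 * (2 ^ n) ^ 5 * ((6 ^ m) ^ 5 * 4 ^ m)
    ≡⟨ cong₂ (λ s t → (k * n) ^ 5 * s * t) (^-comm 2 n 5) (cong (_* 4 ^ m) (^-comm 6 m 5)) ⟩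
      (k * n) ^ 5 * (2 ^ 5) ^ n * ((6 ^ 5) ^ m * 4 ^ m)
    ≡⟨ cong₂ (λ s t → (k * n) ^ 5 * s * t) (^-*-assoc 2 5 n) (sym (^-distribʳ-* (6 ^ 5) 4 m)) ⟩
      (k * n) ^ 5 * 2 ^ (5 * n) * (6 ^ 5 * 4) ^ m
    ≤⟨ *-monoʳ-≤ ((k * n) ^ 5 * 2 ^ (5 * n)) (^-monoˡ-≤ m 6⁵*4≤8⁵) ⟩
      (k * n) ^ 5 * 2 ^ (5 * n) * (8 ^ 5) ^ m ∎)
  where
  open ≤-Reasoning
  open +-*-Solver
  6⁵*4≤8⁵ : 6 ^ 5 * 4 ≤ 8 ^ 5
  6⁵*4≤8⁵ = ≤ᵇ⇒≤ (6 ^ 5 * 4) (8 ^ 5) tt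
  expand : ∀ n k t s f → (n * (k * (t * s))) ^ 5 * f ≡ (k * n) ^ 5 * t ^ 5 * (s ^ 5 * f)
  expand = solve 5 (λ n k t s f →
    (n :* (k :* (t :* s))) :^ 5 :* f := (k :* n) :^ 5 :* t :^ 5 :* (s :^ 5 :* f)) refl

lemma2p5 : (m n k : ℕ) → 2 ≤ m → 2 ≤ n → 2 ≤ k →
    (c : Coloring n k) → Symmetric c →
    (a b : Fin k) → a ≢ b →
    (∀ i j → i ≢ j → c i j ≡ a ⊎ c i j ≡ b) →
    3 * m * n < edgeCount c a → 3 * m * n < edgeCount c b →
    ((w c ∸ 2 ^ n) ^ 5 * 2 ^ (2 * m) ≤ (k * n) ^ 5 * 2 ^ (5 * n))
    × (wNew c ^ 5 * 2 ^ (2 * m) ≤ (k * n) ^ 5 * 2 ^ (5 * n))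
lemma2p5 m n k _ _ _ c _ a b a≢b two many-a many-b = all-extensions , new
  where
  open Counting c
  new : wNew c ^ 5 * 2 ^ (2 * m) ≤ (k * n) ^ 5 * 2 ^ (5 * n)
  new = 8^-bound⇒fifth-power-bound (wNew c) m n k (wNew*8^≤ {m} a≢b many-a many-b)
  w∸2^n≤wNew : w c ∸ 2 ^ n ≤ wNew c
  w∸2^n≤wNew = ≤-trans (∸-monoˡ-≤ (2 ^ n) (w≤wNew+2^n two)) (≤-reflexive (m+n∸n≡m (wNew c) (2 ^ n)))
  all-extensions : (w c ∸ 2 ^ n) ^ 5 * 2 ^ (2 * m) ≤ (k * n) ^ 5 * 2 ^ (5 * n)
  all-extensions = ≤-trans (*-monoˡ-≤ (2 ^ (2 * m)) (^-monoˡ-≤ 5 w∸2^n≤wNew)) new
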